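{- Let $Y\in\mathbb{V}(X)$, let $\phi(x,y_1,\dots,y_m)$ be a totally open formula and, for $i=1,\dots,m$, let $S_i\in\mathbb{V}(X)$, $Q_i\in\{\exists,\forall\}$. Let $\mathcal{U}$ be an ultrafilter on $Y$ that witnesses $\exists x\,Q_1y_1\in S_1\dots Q_my_m\in S_m\,\phi(x,y_1,\dots,y_m)$. Then for every $\alpha\in\mu(\mathcal{U})$, $Q_1y_1\in{}^{\ast}S_1\dots Q_my_m\in{}^{\ast}S_m\ {}^{\ast}\phi(\alpha,y_1,\dots,y_m)$ holds.
   Context: Work in a single superstructure model of nonstandard methods with star map $\ast$ satisfying transfer. Formulas are first-order with bounded quantifiers in the language of $\mathbb{V}(X)$; totally open means all variables free. $\mu(\mathcal{U})=\bigcap_{A\in\mathcal{U}}{}^{\ast}A$. A set $A\subseteq Y$ models $\exists x\,Q_1y_1\in S_1\dots Q_my_m\in S_m\,\phi$ if some $x\in A$ satisfies $Q_1y_1\in S_1\dots Q_my_m\in S_m\,\phi(x,y_1,\dots,y_m)$; $\mathcal{U}$ witnesses the formula if every $A\in\mathcal{U}$ models it. -}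

module Defs where

open import Data.Nat using (ℕ; zero; suc)
open import Data.Fin using (Fin)
open import Data.Vec using (Vec; []; _∷_; lookup; map; reverse)
open import Data.Product using (Σ; _×_; _,_; ∃)
open import Data.Sum using (_⊎_)
open import Data.Unit using (⊤)
open import Data.Empty using (⊥)
open import Relation.Nullary using (¬_)
open import Relation.Binary.PropositionalEquality using (_≡_)
open import Function.Bundles using (_⇔_)

-- Syntax: first-order formulas with bounded quantifiers in the language
-- {∈, =} extended by constants from a set C (the elements of V(X)).
-- Variables are de Bruijn indices; a bounded quantifier binds var zero.

data Term (C : Set) (n : ℕ) : Set where
  var   : Fin n → Term C n
  const : C → Term C n

data Formula (C : Set) (n : ℕ) : Set where
  _∈'_ : Term C n → Term C n → Formula C n
  _≈'_ : Term C n → Term C n → Formula C n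
  ¬'_  : Formula C n → Formula C n
  _∧'_ : Formula C n → Formula C n → Formula C n
  _∨'_ : Formula C n → Formula C n → Formula C n
  _⇒'_ : Formula C n → Formula C n → Formula C n
  ∀∈   : Term C n → Formula C (suc n) → Formula C n
  ∃∈   : Term C n → Formula C (suc n) → Formula C n

-- "totally open": no quantifiers at all, every variable occurrence is free
data QuantifierFree {C : Set} {n : ℕ} : Formula C n → Set where
  qf-∈ : ∀ s t → QuantifierFree (s ∈' t)
  qf-≈ : ∀ s t → QuantifierFree (s ≈' t)
  qf-¬ : ∀ {φ} → QuantifierFree φ → QuantifierFree (¬' φ)
  qf-∧ : ∀ {φ ψ} → QuantifierFree φ → QuantifierFree ψ → QuantifierFree (φ ∧' ψ)
  qf-∨ : ∀ {φ ψ} → QuantifierFree φ → QuantifierFree ψ → QuantifierFree (φ ∨' ψ)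
  qf-⇒ : ∀ {φ ψ} → QuantifierFree φ → QuantifierFree ψ → QuantifierFree (φ ⇒' ψ)

data Quant : Set where
  ∃q ∀q : Quant

bounded : ∀ {C n} → Quant → Term C n → Formula C (suc n) → Formula C n
bounded ∃q t φ = ∃∈ t φ
bounded ∀q t φ = ∀∈ t φ

-- The argument vector lists the pairs INNERMOST FIRST:
--   (Q_m , S_m) ∷ ... ∷ (Q_1 , S_1) ∷ [].
-- Variable convention in φ : Formula C (suc m):
--   var i (i < m) is y_{m-i}, and var m is x.
quantPrefix : ∀ {C m} → Vec (Quant × C) m → Formula C (suc m) → Formula C 1
quantPrefix []             φ = φ
quantPrefix ((q , S) ∷ qs) φ = quantPrefix qs (bounded q (const S) φ)

-- Outermost-first version, matching the paper's order Q_1 ... Q_m.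
prefix : ∀ {C m} → Vec (Quant × C) m → Formula C (suc m) → Formula C 1
prefix qs φ = quantPrefix (reverse qs) φ

module Semantics {C D : Set} (mem : D → D → Set) (c : C → D) where

  ⟦_⟧t : ∀ {n} → Term C n → Vec D n → D
  ⟦ var i   ⟧t ρ = lookup ρ i
  ⟦ const a ⟧t ρ = c a

  Sat : ∀ {n} → Formula C n → Vec D n → Set
  Sat (s ∈' t)  ρ = mem (⟦ s ⟧t ρ) (⟦ t ⟧t ρ)
  Sat (s ≈' t)  ρ = ⟦ s ⟧t ρ ≡ ⟦ t ⟧t ρ
  Sat (¬' φ)    ρ = ¬ Sat φ ρ
  Sat (φ ∧' ψ)  ρ = Sat φ ρ × Sat ψ ρ
  Sat (φ ∨' ψ)  ρ = Sat φ ρ ⊎ Sat ψ ρ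
  Sat (φ ⇒' ψ)  ρ = Sat φ ρ → Sat ψ ρ
  Sat (∀∈ t φ)  ρ = ∀ d → mem d (⟦ t ⟧t ρ) → Sat φ (d ∷ ρ)
  Sat (∃∈ t φ)  ρ = Σ D λ d → mem d (⟦ t ⟧t ρ) × Sat φ (d ∷ ρ)

-- A superstructure model of nonstandard methods:
--   * 𝕍 : the superstructure V(X), with membership _∈_ and atoms X;
--   * 𝕎 : the target universe (containing *V(X)), with membership _∈*_;
--   * star : 𝕍 → 𝕎 the star map, satisfying transfer for all bounded
--     formulas with parameters from V(X).

record NonstandardModel : Set₁ where
  field
    𝕍     : Set
    _∈_   : 𝕍 → 𝕍 → Set
    atom  : 𝕍 → Set
    atoms-empty : ∀ a z → atom a → ¬ (z ∈ a)
    extensional : ∀ A B → ¬ atom A → ¬ atom B →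
                  (∀ z → (z ∈ A) ⇔ (z ∈ B)) → A ≡ B
    -- superstructure: every subset of a set of V(X) belongs to V(X)
    subsets     : ∀ Y → ¬ atom Y → (P : 𝕍 → Set) →
                  Σ 𝕍 λ B → ¬ atom B × (∀ z → (z ∈ B) ⇔ ((z ∈ Y) × P z))
    𝕎     : Set
    _∈*_  : 𝕎 → 𝕎 → Set
    star  : 𝕍 → 𝕎

  module Std = Semantics _∈_  (λ a → a)
  module Ns  = Semantics _∈*_ star

  -- standard satisfaction, and satisfaction of the star-transform *φ
  SatV : ∀ {n} → Formula 𝕍 n → Vec 𝕍 n → Set
  SatV = Std.Sat

  SatW : ∀ {n} → Formula 𝕍 n → Vec 𝕎 n → Set
  SatW = Ns.Sat

  field
    transfer : ∀ {n} (φ : Formula 𝕍 n) (ρ : Vec 𝕍 n) →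
               SatV φ ρ ⇔ SatW φ (map star ρ)

module _ (M : NonstandardModel) where
  open NonstandardModel M

  _⊆_ : 𝕍 → 𝕍 → Set
  A ⊆ B = ∀ z → z ∈ A → z ∈ B

  record IsUltrafilter (U Y : 𝕍) : Set where
    field
      Y-set     : ¬ atom Y
      U-set     : ¬ atom U
      members   : ∀ A → A ∈ U → ¬ atom A × A ⊆ Y
      whole     : Y ∈ U
      nonempty  : ∀ A → A ∈ U → Σ 𝕍 λ z → z ∈ A
      inter     : ∀ A B C → A ∈ U → B ∈ U → ¬ atom C →
                  (∀ z → (z ∈ C) ⇔ ((z ∈ A) × (z ∈ B))) → C ∈ U
      upward    : ∀ A B → A ∈ U → ¬ atom B → A ⊆ B → B ⊆ Y → B ∈ U
      ultra     : ∀ A → ¬ atom A → A ⊆ Y →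
                  (A ∈ U) ⊎
                  (∀ C → ¬ atom C → (∀ z → (z ∈ C) ⇔ ((z ∈ Y) × ¬ (z ∈ A))) → C ∈ U)

  Models : ∀ {m} → 𝕍 → Vec (Quant × 𝕍) m → Formula 𝕍 (suc m) → Set
  Models A qs φ = SatV (∃∈ (const A) (prefix qs φ)) []

  Witnesses : ∀ {m} → 𝕍 → Vec (Quant × 𝕍) m → Formula 𝕍 (suc m) → Set
  Witnesses U qs φ = ∀ A → A ∈ U → Models A qs φ

  _∈μ_ : 𝕎 → 𝕍 → Set
  α ∈μ U = ∀ A → A ∈ U → α ∈* star A

module Submission where

-- Let ψ(x) be the prefixed formula
-- Q₁y₁∈S₁ … Qₘyₘ∈Sₘ φ(x,y₁,…,yₘ) and A = {z ∈ Y | ψ(z)}, a set of V(X)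
-- by the superstructure axiom.  Because U witnesses ∃x ψ(x), every member
-- of U meets A; for an ultrafilter this forces A ∈ U, since otherwise the
-- complement Y ∖ A would be a member of U disjoint from A.  As ψ holds at
-- every element of A, transfer of the bounded formula ∀x∈A ψ(x) shows that
-- *ψ holds at every element of *A, and every α ∈ μ(U) lies in *A.
--
-- The corollary then combines them.

open import Defs
open import Data.Nat using (ℕ; suc)
open import Data.Product using (Σ; _×_; _,_; proj₁; proj₂)
open import Data.Sum using (inj₁; inj₂)
open import Data.Empty using (⊥-elim)
open import Data.Vec using (Vec; []; _∷_; map)
open import Relation.Nullary using (¬_)
open import Function.Bundles using (_⇔_; Equivalence)
open NonstandardModel using (𝕍; 𝕎; SatW)

module _ (M : NonstandardModel) where
  open NonstandardModel M hiding (𝕍; 𝕎; SatW)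
  open Equivalence using (to; from)

  -- An ultrafilter U on Y contains every subset B = {z ∈ Y | P z} that
  -- meets all members of U: otherwise Y ∖ B ∈ U, yet Y ∖ B misses B.
  meets-all-members⇒member :
    ∀ {U Y} → IsUltrafilter M U Y → (P : 𝕍 M → Set) →
    (∀ A → A ∈ U → Σ (𝕍 M) λ z → z ∈ A × P z) →
    ∀ B → ¬ atom B → (∀ z → (z ∈ B) ⇔ ((z ∈ Y) × P z)) → B ∈ U
  meets-all-members⇒member {Y = Y} uf P meets B B-set B-spec
    with IsUltrafilter.ultra uf B B-set (λ z z∈B → proj₁ (to (B-spec z) z∈B))
  ... | inj₁ B∈U = B∈U
  ... | inj₂ complement∈U =
          ⊥-elim (Y∖B-misses-P (meets Y∖B (complement∈U Y∖B Y∖B-set Y∖B-spec)))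
    where
    Y∖B-def : Σ (𝕍 M) λ C → ¬ atom C × (∀ z → (z ∈ C) ⇔ ((z ∈ Y) × ¬ (z ∈ B)))
    Y∖B-def = subsets Y (IsUltrafilter.Y-set uf) (λ z → ¬ (z ∈ B))

    Y∖B : 𝕍 M
    Y∖B = proj₁ Y∖B-def

    Y∖B-set : ¬ atom Y∖B
    Y∖B-set = proj₁ (proj₂ Y∖B-def)

    Y∖B-spec : ∀ z → (z ∈ Y∖B) ⇔ ((z ∈ Y) × ¬ (z ∈ B))
    Y∖B-spec = proj₂ (proj₂ Y∖B-def)

    Y∖B-misses-P : ¬ (Σ (𝕍 M) λ z → z ∈ Y∖B × P z)
    Y∖B-misses-P (z , z∈Y∖B , Pz) with to (Y∖B-spec z) z∈Y∖B
    ... | z∈Y , z∉B = z∉B (from (B-spec z) (z∈Y , Pz))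

  transfer-∀∈ : ∀ {n} (ψ : Formula (𝕍 M) (suc n)) (ρ : Vec (𝕍 M) n) (A : 𝕍 M) →
    (∀ z → z ∈ A → SatV ψ (z ∷ ρ)) →
    ∀ α → α ∈* star A → NonstandardModel.SatW M ψ (α ∷ map star ρ)
  transfer-∀∈ ψ ρ A ψ-on-A = to (transfer (∀∈ (const A) ψ) ρ) ψ-on-A

corollary5p14 : (M : NonstandardModel) (Y : 𝕍 M) (m : ℕ)
    (φ : Formula (𝕍 M) (suc m)) → QuantifierFree φ →
    (qs : Vec (Quant × 𝕍 M) m) (U : 𝕍 M) →
    IsUltrafilter M U Y → Witnesses M U qs φ →
    (α : 𝕎 M) → _∈μ_ M α U → SatW M (prefix qs φ) (α ∷ [])
corollary5p14 M Y m φ _ qs U uf witnesses α α∈μU =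
  transfer-∀∈ M ψ [] A (λ z z∈A → proj₂ (to (A-spec z) z∈A)) α (α∈μU A A∈U)
  where
  open NonstandardModel M using (_∈_; atom; subsets; SatV)
  open Equivalence using (to)

  ψ : Formula (𝕍 M) 1
  ψ = prefix qs φ

  A-def : Σ (𝕍 M) λ B → ¬ atom B × (∀ z → (z ∈ B) ⇔ ((z ∈ Y) × SatV ψ (z ∷ [])))
  A-def = subsets Y (IsUltrafilter.Y-set uf) (λ z → SatV ψ (z ∷ []))

  A : 𝕍 M
  A = proj₁ A-def

  A-spec : ∀ z → (z ∈ A) ⇔ ((z ∈ Y) × SatV ψ (z ∷ []))
  A-spec = proj₂ (proj₂ A-def)

  A∈U : A ∈ U
  A∈U = meets-all-members⇒member M uf (λ z → SatV ψ (z ∷ [])) witnesses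
          A (proj₁ (proj₂ A-def)) A-spec
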